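{- There is no triple threat $(x,p,q,r)$ with $x\equiv p\equiv q\equiv 1 \pmod 5$.
   Context: A triple threat is a quadruple $(x,p,q,r)$ of primes, all greater than $3$, such that $x^2+x+1=(p^2+p+1)(q^2+q+1)(r^2+r+1)$ and each of $p^2+p+1$, $q^2+q+1$, $r^2+r+1$ is prime. -}

module Defs where

open import Data.Nat using (ℕ; _+_; _*_; _<_)
open import Data.Product using (_×_)
open import Relation.Binary.PropositionalEquality using (_≡_)
open import Data.Nat.Primality using (Prime)

Φ : ℕ → ℕ
Φ n = n * n + n + 1

TripleThreat : ℕ → ℕ → ℕ → ℕ → Set
TripleThreat x p q r =
  (Prime x × Prime p × Prime q × Prime r) ×
  (3 < x × 3 < p × 3 < q × 3 < r) ×
  (Φ x ≡ Φ p * Φ q * Φ r) ×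
  (Prime (Φ p) × Prime (Φ q) × Prime (Φ r))

module Submission where

-- The proof works in the Eisenstein integers ℤ[ω], ω² + ω + 1 = 0, where
-- Φ(n) = n² + n + 1 is the norm of n - ω.  If Φ(P) is a rational prime, it
-- splits as (P - ω)(P - ω̄), and a Euclid-type argument shows that any α whose
-- norm is divisible by Φ(P) is divisible by P - ω or by P - ω̄.  Peeling off
-- the three prime factors of N(x - ω) = Φ(p)Φ(q)Φ(r) therefore writes
--   x - ω = ε · ψ(r) · ψ(q) · ψ(p),
-- with ε one of the six units and each ψ(P) ∈ {P - ω, P - ω̄}.
-- Since Φ(p), Φ(q), Φ(r) are primes > 3, p, q, r are ≡ 2 (mod 3), and x ≢ 0.
-- Reducing the factorisation modulo 3 and modulo 5 leaves finitely many
-- residue configurations (unit, conjugate choices, x mod 3, r mod 5); a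
-- decision procedure checks that none of them is consistent.

open import Defs
open import Data.Nat using (ℕ; _%_)
open import Data.Product using (_×_)
open import Relation.Binary.PropositionalEquality using (_≡_)
open import Relation.Nullary using (¬_)

open import Data.Bool using (Bool; true; false)
open import Data.Empty using (⊥-elim)
open import Data.Integer using (ℤ; +_; -[1+_]; _+_; _-_; _*_; -_; ∣_∣)
import Data.Integer as ℤ
import Data.Integer.Properties as ℤ
open import Data.Integer.Divisibility.Signed
  using (_∣_; divides; _∣?_; ∣ᵤ⇒∣; ∣⇒∣ᵤ; ∣m∣n⇒∣m+n; ∣m∣n⇒∣m-n; ∣m⇒∣m*n; ∣n⇒∣m*n; ∣m⇒∣-m)
open import Data.Integer.Tactic.RingSolver using (solve-∀)
import Data.Nat as ℕ
import Data.Nat.Properties as ℕ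
import Data.Nat.Divisibility as ℕ
import Data.Nat.Tactic.RingSolver as ℕ-Solver
open import Data.Nat.DivMod using (_/_; m≡m%n+[m/n]*n; m%n<n)
open import Data.Nat.Primality
  using (Prime; euclidsLemma; prime⇒nonZero; prime⇒¬composite; composite-≢)
open import Data.List using (List; []; _∷_; upTo)
open import Data.List.Membership.Propositional using (_∈_)
open import Data.List.Membership.Propositional.Properties using (∈-upTo⁺)
open import Data.List.Relation.Unary.Any using (here; there)
open import Data.List.Relation.Unary.All using (All; all?)
import Data.List.Relation.Unary.All as All
open import Data.Vec using (Vec; []; _∷_)
import Data.Vec.Relation.Unary.All as Vec
open import Data.Vec.Relation.Binary.Pointwise.Inductive using (Pointwise; []; _∷_)
open import Data.Product using (∃₂; _,_)
open import Data.Sum using (_⊎_; inj₁; inj₂)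
open import Relation.Nullary.Decidable using (Dec; ¬?; map′; from-yes; _×-dec_)
open import Relation.Binary.PropositionalEquality
  using (_≢_; refl; sym; trans; cong; cong₂; subst; module ≡-Reasoning)

open ≡-Reasoning

-- The Eisenstein integers

-- The pair (a , b) stands for a + bω, where ω² = -1 - ω; the product below
-- is (a + bω)(c + dω) expanded with this rule.
ℤ[ω] : Set
ℤ[ω] = ℤ × ℤ

infixl 7 _·_
_·_ : ℤ[ω] → ℤ[ω] → ℤ[ω]
(a , b) · (c , d) = a * c - b * d , a * d + b * c - b * d

-- The norm N(a + bω) = (a + bω)(a + bω̄) = a² - ab + b².
N : ℤ[ω] → ℤ
N (a , b) = a * a - a * b + b * b

N-· : ∀ α β → N (α · β) ≡ N α * N β
N-· (a , b) (c , d) = identity a b c d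
  where
  identity : ∀ a b c d →
    (a * c - b * d) * (a * c - b * d) - (a * c - b * d) * (a * d + b * c - b * d)
      + (a * d + b * c - b * d) * (a * d + b * c - b * d)
    ≡ (a * a - a * b + b * b) * (c * c - c * d + d * d)
  identity = solve-∀

Φᶻ : ℤ → ℤ
Φᶻ P = P * P + P + + 1

Φᶻ-+ : ∀ n → Φᶻ (+ n) ≡ + Φ n
Φᶻ-+ n = sym (begin
  + (n ℕ.* n ℕ.+ n ℕ.+ 1)      ≡⟨ ℤ.pos-+ (n ℕ.* n ℕ.+ n) 1 ⟩
  + (n ℕ.* n ℕ.+ n) + + 1      ≡⟨ cong (_+ + 1) (ℤ.pos-+ (n ℕ.* n) n) ⟩
  + (n ℕ.* n) + + n + + 1      ≡⟨ cong (λ m → m + + n + + 1) (ℤ.pos-* n n) ⟩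
  + n * + n + + n + + 1        ∎)

-- The two conjugate elements of norm Φ(P): ψ false P = P - ω and
-- ψ true P = P - ω̄ = (P + 1) + ω.
ψ : Bool → ℤ → ℤ[ω]
ψ false P = P , - + 1
ψ true  P = P + + 1 , + 1

N-ψ : ∀ s P → N (ψ s P) ≡ Φᶻ P
N-ψ false P = identity P
  where
  identity : ∀ P → P * P - P * (- + 1) + (- + 1) * (- + 1) ≡ P * P + P + + 1
  identity = solve-∀
N-ψ true P = identity P
  where
  identity : ∀ P → (P + + 1) * (P + + 1) - (P + + 1) * + 1 + + 1 * + 1 ≡ P * P + P + + 1
  identity = solve-∀

-- Splitting off a prime factor Φ(P)

euclid-ℤ : ∀ {k} i j → Prime ∣ k ∣ → k ∣ i * j → (k ∣ i) ⊎ (k ∣ j)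
euclid-ℤ {k} i j prime-k k∣ij
  with euclidsLemma ∣ i ∣ ∣ j ∣ prime-k (subst (∣ k ∣ ℕ.∣_) (ℤ.abs-* i j) (∣⇒∣ᵤ k∣ij))
... | inj₁ k∣i = inj₁ (∣ᵤ⇒∣ k∣i)
... | inj₂ k∣j = inj₂ (∣ᵤ⇒∣ k∣j)

-- (a + bP)(a - b - bP) = N(a + bω) - b²Φ(P), so Φ(P) ∣ N(a + bω) forces Φ(P) to
-- divide this product.
Φ∣conjugate-product : ∀ P a b M → N (a , b) ≡ Φᶻ P * M →
                      Φᶻ P ∣ (a + b * P) * (a - b - b * P)
Φ∣conjugate-product P a b M NαM = divides (M - b * b) (begin
  (a + b * P) * (a - b - b * P)            ≡⟨ expand a b P ⟩
  N (a , b) - b * b * Φᶻ P                 ≡⟨ cong (_- b * b * Φᶻ P) NαM ⟩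
  Φᶻ P * M - b * b * Φᶻ P                  ≡⟨ collect (Φᶻ P) M b ⟩
  (M - b * b) * Φᶻ P                       ∎)
  where
  expand : ∀ a b P → (a + b * P) * (a - b - b * P)
                   ≡ (a * a - a * b + b * b) - b * b * (P * P + P + + 1)
  expand = solve-∀
  collect : ∀ φ M b → φ * M - b * b * φ ≡ (M - b * b) * φ
  collect = solve-∀

divides-ψ-false : ∀ P a b t → a + b * P ≡ t * Φᶻ P →
                  (a , b) ≡ (t * (P + + 1) - b , t) · ψ false P
divides-ψ-false P a b t eq = cong₂ _,_ (trans a≡ (first t b P)) (second t b P)
  where
  a≡ : a ≡ t * Φᶻ P - b * P
  a≡ = trans (isolate a (b * P)) (cong (_- b * P) eq)
    where
    isolate : ∀ a c → a ≡ (a + c) - c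
    isolate = solve-∀
  first : ∀ t b P → t * (P * P + P + + 1) - b * P ≡ (t * (P + + 1) - b) * P - t * (- + 1)
  first = solve-∀
  second : ∀ t b P → b ≡ (t * (P + + 1) - b) * (- + 1) + t * P - t * (- + 1)
  second = solve-∀

divides-ψ-true : ∀ P a b t → a - b - b * P ≡ t * Φᶻ P →
                 (a , b) ≡ (t * P + b , - t) · ψ true P
divides-ψ-true P a b t eq = cong₂ _,_ (trans a≡ (first t b P)) (second t b P)
  where
  a≡ : a ≡ t * Φᶻ P + (b + b * P)
  a≡ = trans (isolate a b P) (cong (_+ (b + b * P)) eq)
    where
    isolate : ∀ a b P → a ≡ (a - b - b * P) + (b + b * P)
    isolate = solve-∀
  first : ∀ t b P → t * (P * P + P + + 1) + (b + b * P) ≡ (t * P + b) * (P + + 1) - (- t) * + 1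
  first = solve-∀
  second : ∀ t b P → b ≡ (t * P + b) * + 1 + (- t) * (P + + 1) - (- t) * + 1
  second = solve-∀

cancel-norm : ∀ {α c M} .{{_ : ℤ.NonZero c}} β γ →
              α ≡ β · γ → N γ ≡ c → N α ≡ c * M → N β ≡ M
cancel-norm {c = c} {M} β γ refl Nγ≡c Nα≡cM = ℤ.*-cancelˡ-≡ c (N β) M (begin
  c * N β       ≡⟨ ℤ.*-comm c (N β) ⟩
  N β * c       ≡⟨ cong (N β *_) (sym Nγ≡c) ⟩
  N β * N γ     ≡⟨ sym (N-· β γ) ⟩
  N (β · γ)     ≡⟨ Nα≡cM ⟩
  c * M         ∎)

split : ∀ P → Prime ∣ Φᶻ P ∣ → ∀ α M → N α ≡ Φᶻ P * M →
        ∃₂ λ s β → α ≡ β · ψ s P × N β ≡ M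
split P prime-Φ (a , b) M NαM
  with euclid-ℤ (a + b * P) (a - b - b * P) prime-Φ (Φ∣conjugate-product P a b M NαM)
... | inj₁ (divides t eq) = false , β , α≡ , cancel-norm β (ψ false P) α≡ (N-ψ false P) NαM
  where
  instance _ = prime⇒nonZero prime-Φ
  β : ℤ[ω]
  β = t * (P + + 1) - b , t
  α≡ : (a , b) ≡ β · ψ false P
  α≡ = divides-ψ-false P a b t eq
... | inj₂ (divides t eq) = true , β , α≡ , cancel-norm β (ψ true P) α≡ (N-ψ true P) NαM
  where
  instance _ = prime⇒nonZero prime-Φ
  β : ℤ[ω]
  β = t * P + b , - t
  α≡ : (a , b) ≡ β · ψ true P
  α≡ = divides-ψ-true P a b t eq

-- The units of ℤ[ω]

-- ±1, ±ω and ±ω² = ∓(1 + ω).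
units : List ℤ[ω]
units = (+ 1 , + 0) ∷ (- + 1 , + 0) ∷ (+ 0 , + 1) ∷ (+ 0 , - + 1) ∷ (+ 1 , + 1) ∷ (- + 1 , - + 1) ∷ []

small-of-four : ∀ c v → c ℕ.* c ℕ.+ 3 ℕ.* (v ℕ.* v) ≡ 4 → v ℕ.≤ 1
small-of-four c 0 _ = ℕ.z≤n
small-of-four c 1 _ = ℕ.≤-refl
small-of-four c v@(ℕ.suc (ℕ.suc k)) eq =
  ⊥-elim (ℕ.≤⇒≯ (ℕ.≤-reflexive eq) (ℕ.<-≤-trans (from-yes (4 ℕ.<? 12)) 12≤))
  where
  12≤ : 12 ℕ.≤ c ℕ.* c ℕ.+ 3 ℕ.* (v ℕ.* v)
  12≤ = ℕ.≤-trans (ℕ.*-monoʳ-≤ 3 (ℕ.*-mono-≤ {2} {v} {2} {v} (ℕ.s≤s (ℕ.s≤s ℕ.z≤n)) (ℕ.s≤s (ℕ.s≤s ℕ.z≤n))))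
                  (ℕ.m≤n+m _ (c ℕ.* c))

square-abs : ∀ z → z * z ≡ + (∣ z ∣ ℕ.* ∣ z ∣)
square-abs (+ n) = sym (ℤ.pos-* n n)
square-abs -[1+ n ] = refl

-- From 4 N(a + bω) = (2a - b)² + 3b²: a unit has |b| ≤ 1.
unit-bound : ∀ a b → N (a , b) ≡ + 1 → ∣ b ∣ ℕ.≤ 1
unit-bound a b N≡1 = small-of-four ∣ c ∣ ∣ b ∣ (ℤ.+-injective (begin
  + (∣ c ∣ ℕ.* ∣ c ∣ ℕ.+ 3 ℕ.* (∣ b ∣ ℕ.* ∣ b ∣))     ≡⟨ ℤ.pos-+ (∣ c ∣ ℕ.* ∣ c ∣) (3 ℕ.* (∣ b ∣ ℕ.* ∣ b ∣)) ⟩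
  + (∣ c ∣ ℕ.* ∣ c ∣) + + (3 ℕ.* (∣ b ∣ ℕ.* ∣ b ∣))   ≡⟨ cong (λ m → + (∣ c ∣ ℕ.* ∣ c ∣) + m) (ℤ.pos-* 3 (∣ b ∣ ℕ.* ∣ b ∣)) ⟩
  + (∣ c ∣ ℕ.* ∣ c ∣) + + 3 * + (∣ b ∣ ℕ.* ∣ b ∣)     ≡⟨ sym (cong₂ (λ u v → u + + 3 * v) (square-abs c) (square-abs b)) ⟩
  c * c + + 3 * (b * b)                                  ≡⟨ sym (four-N a b) ⟩
  + 4 * N (a , b)                                        ≡⟨ cong (+ 4 *_) N≡1 ⟩
  + 4                                                    ∎))
  where
  c = + 2 * a - b
  four-N : ∀ a b → + 4 * (a * a - a * b + b * b) ≡ (+ 2 * a - b) * (+ 2 * a - b) + + 3 * (b * b)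
  four-N = solve-∀

-- The norm is symmetric in the two coordinates, so the bound holds for |a| too.
N-swap : ∀ a b → N (b , a) ≡ N (a , b)
N-swap = identity
  where
  identity : ∀ a b → b * b - b * a + a * a ≡ a * a - a * b + b * b
  identity = solve-∀

norm-one⇒unit : ∀ α → N α ≡ + 1 → α ∈ units
norm-one⇒unit (a , b) N≡1 =
  enumerate a b (unit-bound b a (trans (N-swap a b) N≡1)) (unit-bound a b N≡1) N≡1
  where
  enumerate : ∀ a b → ∣ a ∣ ℕ.≤ 1 → ∣ b ∣ ℕ.≤ 1 → N (a , b) ≡ + 1 → (a , b) ∈ units
  enumerate (+ ℕ.suc (ℕ.suc _)) _ (ℕ.s≤s ()) _ _
  enumerate -[1+ ℕ.suc _ ]      _ (ℕ.s≤s ()) _ _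
  enumerate _ (+ ℕ.suc (ℕ.suc _)) _ (ℕ.s≤s ()) _
  enumerate _ -[1+ ℕ.suc _ ]      _ (ℕ.s≤s ()) _
  enumerate (+ 1)    (+ 0)    _ _ _ = here refl
  enumerate -[1+ 0 ] (+ 0)    _ _ _ = there (here refl)
  enumerate (+ 0)    (+ 1)    _ _ _ = there (there (here refl))
  enumerate (+ 0)    -[1+ 0 ] _ _ _ = there (there (there (here refl)))
  enumerate (+ 1)    (+ 1)    _ _ _ = there (there (there (there (here refl))))
  enumerate -[1+ 0 ] -[1+ 0 ] _ _ _ = there (there (there (there (there (here refl)))))
  enumerate (+ 0)    (+ 0)    _ _ ()
  enumerate (+ 1)    -[1+ 0 ] _ _ ()
  enumerate -[1+ 0 ] (+ 1)    _ _ ()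

-- Factorisation of an element whose norm is a product of split primes

Φ-product : ∀ {n} → Vec ℤ n → ℤ
Φ-product []       = + 1
Φ-product (P ∷ Ps) = Φᶻ P * Φ-product Ps

expand : ∀ {n} → ℤ[ω] → Vec Bool n → Vec ℤ n → ℤ[ω]
expand ε []       []       = ε
expand ε (s ∷ ss) (P ∷ Ps) = expand ε ss Ps · ψ s P

factorise : ∀ {n} (Ps : Vec ℤ n) → Vec.All (λ P → Prime ∣ Φᶻ P ∣) Ps →
            ∀ α → N α ≡ Φ-product Ps →
            ∃₂ λ ε ss → ε ∈ units × α ≡ expand ε ss Ps
factorise [] Vec.[] α N≡1 = α , [] , norm-one⇒unit α N≡1 , refl
factorise (P ∷ Ps) (prime-Φ Vec.∷ primes) α Nα≡
  with split P prime-Φ α (Φ-product Ps) Nα≡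
... | s , β , α≡βψ , Nβ≡ with factorise Ps primes β Nβ≡
...   | ε , ss , ε∈ , β≡ = ε , s ∷ ss , ε∈ , trans α≡βψ (cong (_· ψ s P) β≡)

-- Congruences in ℤ and ℤ[ω]

infix 4 _≈_mod_ _≋_mod_

-- a ≈ b mod k: k divides a - b.  A record, so that a, b and k are recoverable
-- from the type.
record _≈_mod_ (a b k : ℤ) : Set where
  constructor ≈-intro
  field divides-difference : k ∣ a - b
open _≈_mod_

_≋_mod_ : ℤ[ω] → ℤ[ω] → ℤ → Set
(a , b) ≋ (c , d) mod k = a ≈ c mod k × b ≈ d mod k

≈-refl : ∀ {k} a → a ≈ a mod k
≈-refl {k} a = ≈-intro (divides (+ 0) (identity a k))
  where
  identity : ∀ a k → a - a ≡ + 0 * k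
  identity = solve-∀

≈-sym : ∀ {k a b} → a ≈ b mod k → b ≈ a mod k
≈-sym {k} {a} {b} (≈-intro k∣a-b) = ≈-intro (subst (k ∣_) (identity a b) (∣m⇒∣-m k∣a-b))
  where
  identity : ∀ a b → - (a - b) ≡ b - a
  identity = solve-∀

≈-trans : ∀ {k a b c} → a ≈ b mod k → b ≈ c mod k → a ≈ c mod k
≈-trans {k} {a} {b} {c} (≈-intro k∣a-b) (≈-intro k∣b-c) =
  ≈-intro (subst (k ∣_) (identity a b c) (∣m∣n⇒∣m+n k∣a-b k∣b-c))
  where
  identity : ∀ a b c → (a - b) + (b - c) ≡ a - c
  identity = solve-∀

≈-+ : ∀ {k a b c d} → a ≈ c mod k → b ≈ d mod k → a + b ≈ c + d mod k
≈-+ {k} {a} {b} {c} {d} (≈-intro k∣a-c) (≈-intro k∣b-d) =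
  ≈-intro (subst (k ∣_) (identity a b c d) (∣m∣n⇒∣m+n k∣a-c k∣b-d))
  where
  identity : ∀ a b c d → (a - c) + (b - d) ≡ (a + b) - (c + d)
  identity = solve-∀

≈-- : ∀ {k a b c d} → a ≈ c mod k → b ≈ d mod k → a - b ≈ c - d mod k
≈-- {k} {a} {b} {c} {d} (≈-intro k∣a-c) (≈-intro k∣b-d) =
  ≈-intro (subst (k ∣_) (identity a b c d) (∣m∣n⇒∣m-n k∣a-c k∣b-d))
  where
  identity : ∀ a b c d → (a - c) - (b - d) ≡ (a - b) - (c - d)
  identity = solve-∀

≈-* : ∀ {k a b c d} → a ≈ c mod k → b ≈ d mod k → a * b ≈ c * d mod k
≈-* {k} {a} {b} {c} {d} (≈-intro k∣a-c) (≈-intro k∣b-d) =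
  ≈-intro (subst (k ∣_) (identity a b c d) (∣m∣n⇒∣m+n (∣m⇒∣m*n b k∣a-c) (∣n⇒∣m*n c k∣b-d)))
  where
  identity : ∀ a b c d → (a - c) * b + c * (b - d) ≡ a * b - c * d
  identity = solve-∀

≋-trans : ∀ {k} α β γ → α ≋ β mod k → β ≋ γ mod k → α ≋ γ mod k
≋-trans (a , b) (c , d) (e , f) (a≈c , b≈d) (c≈e , d≈f) = ≈-trans a≈c c≈e , ≈-trans b≈d d≈f

≋-· : ∀ {k} α β α′ β′ → α ≋ α′ mod k → β ≋ β′ mod k → α · β ≋ α′ · β′ mod k
≋-· (a , b) (c , d) (a′ , b′) (c′ , d′) (a≈ , b≈) (c≈ , d≈) =
  ≈-- (≈-* a≈ c≈) (≈-* b≈ d≈) ,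
  ≈-- (≈-+ (≈-* a≈ d≈) (≈-* b≈ c≈)) (≈-* b≈ d≈)

ψ-cong : ∀ {k} s {P P′} → P ≈ P′ mod k → ψ s P ≋ ψ s P′ mod k
ψ-cong false P≈P′ = P≈P′ , ≈-refl _
ψ-cong true  P≈P′ = ≈-+ P≈P′ (≈-refl _) , ≈-refl _

expand-cong : ∀ {k n} ε (ss : Vec Bool n) {Ps Ps′ : Vec ℤ n} →
              Pointwise (λ P P′ → P ≈ P′ mod k) Ps Ps′ →
              expand ε ss Ps ≋ expand ε ss Ps′ mod k
expand-cong (a , b) [] [] = ≈-refl a , ≈-refl b
expand-cong ε (s ∷ ss) {P ∷ Ps} {P′ ∷ Ps′} (P≈ ∷ Ps≈) =
  ≋-· (expand ε ss Ps) (ψ s P) (expand ε ss Ps′) (ψ s P′) (expand-cong ε ss Ps≈) (ψ-cong s P≈)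

%-≈ : ∀ n k .{{_ : ℕ.NonZero k}} → + n ≈ + (n % k) mod + k
%-≈ n k = ≈-intro (divides (+ (n / k)) (begin
  + n - + r                        ≡⟨ cong (λ m → + m - + r) (m≡m%n+[m/n]*n n k) ⟩
  + (r ℕ.+ n / k ℕ.* k) - + r      ≡⟨ cong (_- + r) (ℤ.pos-+ r (n / k ℕ.* k)) ⟩
  + r + + (n / k ℕ.* k) - + r      ≡⟨ cancel (+ r) (+ (n / k ℕ.* k)) ⟩
  + (n / k ℕ.* k)                  ≡⟨ ℤ.pos-* (n / k) k ⟩
  + (n / k) * + k                  ∎))
  where
  r = n % k
  cancel : ∀ r m → r + m - r ≡ m
  cancel = solve-∀

≈-residue : ∀ n k r .{{_ : ℕ.NonZero k}} → n % k ≡ r → + n ≈ + r mod + k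
≈-residue n k r n%k≡r = subst (λ m → + n ≈ + m mod + k) n%k≡r (%-≈ n k)

-- Residues modulo 3

prime⇒¬∣ : ∀ {n} d .{{_ : ℕ.NonTrivial d}} → Prime n → d ≢ n → ¬ (d ℕ.∣ n)
prime⇒¬∣ d prime-n d≢n d∣n = prime⇒¬composite prime-n (composite-≢ d d≢n d∣n)
  where instance _ = prime⇒nonZero prime-n

3∣Φ[1+3k] : ∀ k → 3 ℕ.∣ Φ (1 ℕ.+ k ℕ.* 3)
3∣Φ[1+3k] k = ℕ.divides (1 ℕ.+ 3 ℕ.* k ℕ.+ 3 ℕ.* k ℕ.* k) (identity k)
  where
  identity : ∀ k → (1 ℕ.+ k ℕ.* 3) ℕ.* (1 ℕ.+ k ℕ.* 3) ℕ.+ (1 ℕ.+ k ℕ.* 3) ℕ.+ 1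
                 ≡ (1 ℕ.+ 3 ℕ.* k ℕ.+ 3 ℕ.* k ℕ.* k) ℕ.* 3
  identity = ℕ-Solver.solve-∀

n≤Φn : ∀ n → n ℕ.≤ Φ n
n≤Φn n = ℕ.≤-trans (ℕ.m≤n+m n (n ℕ.* n)) (ℕ.m≤m+n (n ℕ.* n ℕ.+ n) 1)

-- If p > 3 and Φ(p) are prime then p ≡ 2 (mod 3): p ≢ 0 as p is prime, and
-- p ≡ 1 would give 3 ∣ Φ(p).
split-prime-mod-3 : ∀ p → 3 ℕ.< p → Prime p → Prime (Φ p) → + p ≈ + 2 mod + 3
split-prime-mod-3 p 3<p prime-p prime-Φp = ≈-residue p 3 2 (residue p 3<p prime-p prime-Φp)
  where
  residue : ∀ p → 3 ℕ.< p → Prime p → Prime (Φ p) → p % 3 ≡ 2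
  residue p 3<p prime-p prime-Φp with p % 3 | m%n<n p 3 | m≡m%n+[m/n]*n p 3
  ... | 0 | _ | p≡ = ⊥-elim (prime⇒¬∣ 3 prime-p (ℕ.<⇒≢ 3<p) (ℕ.divides (p / 3) p≡))
  ... | 1 | _ | p≡ = ⊥-elim (prime⇒¬∣ 3 prime-Φp (ℕ.<⇒≢ (ℕ.<-≤-trans 3<p (n≤Φn p)))
                        (subst (λ n → 3 ℕ.∣ Φ n) (sym p≡) (3∣Φ[1+3k] (p / 3))))
  ... | 2 | _ | _  = refl
  ... | ℕ.suc (ℕ.suc (ℕ.suc _)) | ℕ.s≤s (ℕ.s≤s (ℕ.s≤s ())) | _

prime-mod-3 : ∀ x → 3 ℕ.< x → Prime x → x % 3 ∈ (1 ∷ 2 ∷ [])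
prime-mod-3 x 3<x prime-x with x % 3 | m%n<n x 3 | m≡m%n+[m/n]*n x 3
... | 0 | _ | x≡ = ⊥-elim (prime⇒¬∣ 3 prime-x (ℕ.<⇒≢ 3<x) (ℕ.divides (x / 3) x≡))
... | 1 | _ | _  = here refl
... | 2 | _ | _  = there (here refl)
... | ℕ.suc (ℕ.suc (ℕ.suc _)) | ℕ.s≤s (ℕ.s≤s (ℕ.s≤s ())) | _

-- The finite check

bools : List Bool
bools = false ∷ true ∷ []

∈-bools : ∀ s → s ∈ bools
∈-bools false = here refl
∈-bools true  = there (here refl)

≋? : ∀ α β k → Dec (α ≋ β mod k)
≋? (a , b) (c , d) k = ≈? a c ×-dec ≈? b d
  where
  ≈? : ∀ a b → Dec (a ≈ b mod k)
  ≈? a b = map′ ≈-intro divides-difference (k ∣? a - b)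

-- A configuration (unit ε, conjugate choices ss, x mod 3, r mod 5) is
-- compatible when x - ω = ε · ψ r · ψ q · ψ p survives reduction modulo 3
-- (where p ≡ q ≡ r ≡ 2) and modulo 5 (where x ≡ p ≡ q ≡ 1).
Compatible : ℤ[ω] → Vec Bool 3 → ℕ → ℕ → Set
Compatible ε ss x₃ r₅ =
  (+ x₃ , - + 1) ≋ expand ε ss (+ 2 ∷ + 2 ∷ + 2 ∷ []) mod + 3 ×
  (+ 1 , - + 1) ≋ expand ε ss (+ 1 ∷ + 1 ∷ + r₅ ∷ []) mod + 5

compatible? : ∀ ε ss x₃ r₅ → Dec (Compatible ε ss x₃ r₅)
compatible? ε ss x₃ r₅ =
  ≋? (+ x₃ , - + 1) (expand ε ss (+ 2 ∷ + 2 ∷ + 2 ∷ [])) (+ 3) ×-dec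
  ≋? (+ 1 , - + 1) (expand ε ss (+ 1 ∷ + 1 ∷ + r₅ ∷ [])) (+ 5)

no-compatible-configuration :
  All (λ ε → All (λ s₁ → All (λ s₂ → All (λ s₃ → All (λ x₃ → All (λ r₅ →
    ¬ Compatible ε (s₁ ∷ s₂ ∷ s₃ ∷ []) x₃ r₅)
    (upTo 5)) (1 ∷ 2 ∷ [])) bools) bools) bools) units
no-compatible-configuration = from-yes
  (all? (λ ε → all? (λ s₁ → all? (λ s₂ → all? (λ s₃ → all? (λ x₃ → all? (λ r₅ →
    ¬? (compatible? ε (s₁ ∷ s₂ ∷ s₃ ∷ []) x₃ r₅))
    (upTo 5)) (1 ∷ 2 ∷ [])) bools) bools) bools) units)

incompatible : ∀ {ε x₃ r₅} ss → ε ∈ units → x₃ ∈ (1 ∷ 2 ∷ []) → r₅ ∈ upTo 5 →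
               ¬ Compatible ε ss x₃ r₅
incompatible (s₁ ∷ s₂ ∷ s₃ ∷ []) ε∈ x₃∈ r₅∈ =
  All.lookup (All.lookup (All.lookup (All.lookup (All.lookup (All.lookup
    no-compatible-configuration ε∈) (∈-bools s₁)) (∈-bools s₂)) (∈-bools s₃)) x₃∈) r₅∈

prime-Φᶻ : ∀ n → Prime (Φ n) → Prime ∣ Φᶻ (+ n) ∣
prime-Φᶻ n = subst (λ m → Prime ∣ m ∣) (sym (Φᶻ-+ n))

norm-equation : ∀ x p q r → Φ x ≡ Φ p ℕ.* Φ q ℕ.* Φ r →
                N (+ x , - + 1) ≡ Φ-product (+ p ∷ + q ∷ + r ∷ [])
norm-equation x p q r Φx≡ = begin
  N (+ x , - + 1)                        ≡⟨ N-ψ false (+ x) ⟩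
  Φᶻ (+ x)                               ≡⟨ Φᶻ-+ x ⟩
  + Φ x                                  ≡⟨ cong +_ Φx≡ ⟩
  + (Φ p ℕ.* Φ q ℕ.* Φ r)                ≡⟨ ℤ.pos-* (Φ p ℕ.* Φ q) (Φ r) ⟩
  + (Φ p ℕ.* Φ q) * + Φ r                ≡⟨ cong (_* + Φ r) (ℤ.pos-* (Φ p) (Φ q)) ⟩
  + Φ p * + Φ q * + Φ r                  ≡⟨ sym (cong₂ (λ u v → u * v * + Φ r) (Φᶻ-+ p) (Φᶻ-+ q)) ⟩
  Φᶻ (+ p) * Φᶻ (+ q) * + Φ r            ≡⟨ sym (cong (Φᶻ (+ p) * Φᶻ (+ q) *_) (Φᶻ-+ r)) ⟩
  Φᶻ (+ p) * Φᶻ (+ q) * Φᶻ (+ r)         ≡⟨ reassociate (Φᶻ (+ p)) (Φᶻ (+ q)) (Φᶻ (+ r)) ⟩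
  Φᶻ (+ p) * (Φᶻ (+ q) * (Φᶻ (+ r) * + 1)) ∎
  where
  reassociate : ∀ u v w → u * v * w ≡ u * (v * (w * + 1))
  reassociate = solve-∀

no-factorisation : ∀ x p q r →
  + p ≈ + 2 mod + 3 → + q ≈ + 2 mod + 3 → + r ≈ + 2 mod + 3 → x % 3 ∈ (1 ∷ 2 ∷ []) →
  + x ≈ + 1 mod + 5 → + p ≈ + 1 mod + 5 → + q ≈ + 1 mod + 5 →
  ¬ (∃₂ λ ε ss → ε ∈ units × (+ x , - + 1) ≡ expand ε ss (+ p ∷ + q ∷ + r ∷ []))
no-factorisation x p q r p≈2 q≈2 r≈2 x₃∈ x≈1 p≈1 q≈1 (ε , ss , ε∈units , x-ω≡) =
  incompatible ss ε∈units x₃∈ (∈-upTo⁺ (m%n<n r 5)) (modulo-3 , modulo-5)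
  where
  reduce : ∀ {k} Ps′ → Pointwise (λ P P′ → P ≈ P′ mod k) (+ p ∷ + q ∷ + r ∷ []) Ps′ →
           (+ x , - + 1) ≋ expand ε ss Ps′ mod k
  reduce {k} Ps′ Ps≈ = subst (λ α → α ≋ expand ε ss Ps′ mod k) (sym x-ω≡) (expand-cong ε ss Ps≈)
  modulo-3 : (+ (x % 3) , - + 1) ≋ expand ε ss (+ 2 ∷ + 2 ∷ + 2 ∷ []) mod + 3
  modulo-3 = ≋-trans (+ (x % 3) , - + 1) (+ x , - + 1) (expand ε ss (+ 2 ∷ + 2 ∷ + 2 ∷ []))
    (≈-sym (%-≈ x 3) , ≈-refl (- + 1)) (reduce (+ 2 ∷ + 2 ∷ + 2 ∷ []) (p≈2 ∷ q≈2 ∷ r≈2 ∷ []))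
  modulo-5 : (+ 1 , - + 1) ≋ expand ε ss (+ 1 ∷ + 1 ∷ + (r % 5) ∷ []) mod + 5
  modulo-5 = ≋-trans (+ 1 , - + 1) (+ x , - + 1) (expand ε ss (+ 1 ∷ + 1 ∷ + (r % 5) ∷ []))
    (≈-sym x≈1 , ≈-refl (- + 1)) (reduce (+ 1 ∷ + 1 ∷ + (r % 5) ∷ []) (p≈1 ∷ q≈1 ∷ %-≈ r 5 ∷ []))

lemma21 : (x p q r : ℕ) → TripleThreat x p q r →
          ¬ (x % 5 ≡ 1 × p % 5 ≡ 1 × q % 5 ≡ 1)
lemma21 x p q r ((prime-x , prime-p , prime-q , prime-r) , (3<x , 3<p , 3<q , 3<r) , Φx≡ ,
                 (prime-Φp , prime-Φq , prime-Φr)) (x≡1 , p≡1 , q≡1) =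
  no-factorisation x p q r
    (split-prime-mod-3 p 3<p prime-p prime-Φp) (split-prime-mod-3 q 3<q prime-q prime-Φq)
    (split-prime-mod-3 r 3<r prime-r prime-Φr) (prime-mod-3 x 3<x prime-x)
    (≈-residue x 5 1 x≡1) (≈-residue p 5 1 p≡1) (≈-residue q 5 1 q≡1)
    (factorise (+ p ∷ + q ∷ + r ∷ [])
               (prime-Φᶻ p prime-Φp Vec.∷ prime-Φᶻ q prime-Φq Vec.∷ prime-Φᶻ r prime-Φr Vec.∷ Vec.[])
               (+ x , - + 1) (norm-equation x p q r Φx≡))
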